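{- Let $T$ be a tree on $n\geq 4$ vertices with no pair of false-twin vertices. Then $T$ has at least $\lceil \frac{n}{2} \rceil$ bicliques.
   Context: A biclique of a graph is a maximal (with respect to vertex-set inclusion) induced subgraph that is a complete bipartite graph $K_{p,q}$ with $p,q\geq 1$; bicliques are counted as distinct vertex sets. Two distinct vertices $u,v$ are false-twins if $N(u)=N(v)$, where $N(\cdot)$ denotes the open neighborhood. -}

module Defs where

open import Data.Nat using (ℕ; _≤_)
open import Data.Bool using (Bool; true; false)
open import Data.Fin using (Fin)
open import Data.Fin.Subset using (Subset; _∈_; _⊆_)
open import Data.List using (List; []; _∷_; _∷ʳ_; length)
open import Data.List.Relation.Unary.Unique.Propositional using (Unique)
open import Data.Product using (Σ; ∃; ∃-syntax; _×_)
open import Relation.Binary.PropositionalEquality using (_≡_; _≢_)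
open import Relation.Nullary using (¬_)
open import Data.Unit using (⊤)

record Graph (n : ℕ) : Set where
  field
    adj      : Fin n → Fin n → Bool
    irrefl   : ∀ u → adj u u ≡ false
    sym      : ∀ u v → adj u v ≡ adj v u

open Graph public

module _ {n : ℕ} (G : Graph n) where

  Adj : Fin n → Fin n → Set
  Adj u v = adj G u v ≡ true

  data Walk : Fin n → Fin n → Set where
    stay : ∀ {u} → Walk u u
    step : ∀ {u w v} → Adj u w → Walk w v → Walk u v

  Connected : Set
  Connected = ∀ u v → Walk u v

  Chain : List (Fin n) → Set
  Chain []           = ⊤
  Chain (x ∷ [])     = ⊤
  Chain (x ∷ y ∷ zs) = Adj x y × Chain (y ∷ zs)

  HasCycle : Set
  HasCycle = Σ (Fin n) λ x → Σ (List (Fin n)) λ ys →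
               2 ≤ length ys × Unique (x ∷ ys) × Chain ((x ∷ ys) ∷ʳ x)

  Acyclic : Set
  Acyclic = ¬ HasCycle

  IsTree : Set
  IsTree = Connected × Acyclic

  FalseTwins : Fin n → Fin n → Set
  FalseTwins u v = u ≢ v × (∀ w → adj G u w ≡ adj G v w)

  NoFalseTwins : Set
  NoFalseTwins = ∀ u v → ¬ FalseTwins u v

  -- the subgraph induced by S is a complete bipartite graph K_{p,q}, p,q ≥ 1:
  -- S splits into two nonempty sides (given by `side`) such that two vertices
  -- of S are adjacent iff they lie on different sides.
  InducesCompleteBipartite : Subset n → Set
  InducesCompleteBipartite S = Σ (Fin n → Bool) λ side →
      (∃[ a ] (a ∈ S × side a ≡ true))
    × (∃[ b ] (b ∈ S × side b ≡ false))
    × (∀ u v → u ∈ S → v ∈ S → (Adj u v → side u ≢ side v) × (side u ≢ side v → Adj u v))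

  IsBiclique : Subset n → Set
  IsBiclique S = InducesCompleteBipartite S
               × (∀ S′ → S ⊆ S′ → InducesCompleteBipartite S′ → S′ ⊆ S)

-- Call a vertex internal if it has at least two neighbours. In a tree the closed
-- neighbourhood N[v] of an internal vertex v is a biclique (the star K_{1,deg v}):
-- it is complete bipartite because there are no triangles, and maximal because a
-- vertex joined to two neighbours of v would close a 4-cycle. Distinct internal
-- vertices give distinct stars. Every leaf hangs on an internal vertex (n ≥ 3 and
-- connectedness), and two leaves on the same vertex would be false twins, so there
-- are at most as many leaves as internal vertices, i.e. at least n/2 internal ones.
module Submission where

open import Defs hiding (sym)
open import Data.Bool using (Bool; true; false)
import Data.Bool.Properties as Bool
open import Data.Empty using (⊥; ⊥-elim)
open import Data.Fin using (Fin) renaming (zero to fzero; suc to fsuc)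
open import Data.Fin.Properties using (_≟_)
open import Data.Fin.Subset using (Subset; ⁅_⁆; _∪_) renaming (_∈_ to _∈ₛ_; _⊆_ to _⊆ₛ_)
open import Data.Fin.Subset.Properties using (x∈⁅x⁆; x∈⁅y⁆⇒x≡y; x∈p∪q⁺; x∈p∪q⁻)
open import Data.List using (List; []; _∷_; length; filter; map; allFin)
open import Data.List.Membership.Propositional using (_∈_)
open import Data.List.Membership.Propositional.Properties using (∈-filter⁺; ∈-filter⁻; ∈-allFin)
open import Data.List.Properties using (length-map; length-tabulate; length-removeAt′)
open import Data.List.Relation.Unary.All using (All; []; _∷_)
import Data.List.Relation.Unary.All as All
import Data.List.Relation.Unary.All.Properties as All
open import Data.List.Relation.Unary.AllPairs using ([]; _∷_)
open import Data.List.Relation.Unary.Any using (here; there; index; _─_)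
open import Data.List.Relation.Unary.Unique.Propositional using (Unique)
import Data.List.Relation.Unary.Unique.Propositional.Properties as Unique
open import Data.Nat using (ℕ; suc; _+_; _≤_; _≤?_; z≤n; s≤s; ⌈_/2⌉)
open import Data.Nat.Properties
  using (+-suc; +-monoʳ-≤; <⇒≤; ≤-pred; ≰⇒>; ⌈n/2⌉-mono; n≡⌈n+n/2⌉; module ≤-Reasoning)
open import Data.Product using (Σ; ∃; ∃₂; ∃-syntax; _×_; _,_; proj₁; proj₂)
open import Data.Sum using (_⊎_; inj₁; inj₂)
open import Data.Unit using (tt)
open import Data.Vec using (tabulate)
open import Data.Vec.Properties using (lookup⇒[]=; []=⇒lookup; lookup∘tabulate)
open import Function.Base using (_∘_)
open import Function.Bundles using (mk⇔)
open import Relation.Binary.PropositionalEquality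
  using (_≡_; _≢_; refl; sym; trans; subst; cong)
open import Relation.Nullary using (¬_; Dec; yes; no; does)
open import Relation.Unary using (Decidable)
open import Relation.Unary.Properties using (∁?)

∈-─ : ∀ {A : Set} {x y : A} {ys} (x∈ys : x ∈ ys) → y ∈ ys → y ≢ x → y ∈ (ys ─ x∈ys)
∈-─ (here refl) (here refl) y≢x = ⊥-elim (y≢x refl)
∈-─ (here refl) (there y∈ys) _  = y∈ys
∈-─ (there _)   (here refl)  _  = here refl
∈-─ (there x∈ys) (there y∈ys) y≢x = there (∈-─ x∈ys y∈ys y≢x)

module _ {A : Set} where

  ∈-length≤1⇒≡ : ∀ {x y : A} {xs} → length xs ≤ 1 → x ∈ xs → y ∈ xs → x ≡ y
  ∈-length≤1⇒≡ {xs = _ ∷ []}    _         (here refl) (here refl) = refl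
  ∈-length≤1⇒≡ {xs = _ ∷ _ ∷ _} (s≤s ()) _ _

  ∃-distinct : ∀ {xs : List A} → Unique xs → 2 ≤ length xs →
               ∃₂ λ a b → a ≢ b × a ∈ xs × b ∈ xs
  ∃-distinct ((a≢b ∷ _) ∷ _) (s≤s (s≤s _)) = _ , _ , a≢b , here refl , there (here refl)

  length-filter+length-filter-∁ : ∀ {P : A → Set} (P? : Decidable P) xs →
    length (filter P? xs) + length (filter (∁? P?) xs) ≡ length xs
  length-filter+length-filter-∁ P? [] = refl
  length-filter+length-filter-∁ P? (x ∷ xs) with P? x
  ... | yes _ = cong suc (length-filter+length-filter-∁ P? xs)
  ... | no _  = trans (+-suc _ _) (cong suc (length-filter+length-filter-∁ P? xs))

  Unique-map⁺ : ∀ {B : Set} {f : A → B} {xs} →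
    (∀ {x y} → x ∈ xs → y ∈ xs → f x ≡ f y → x ≡ y) → Unique xs → Unique (map f xs)
  Unique-map⁺ {xs = []}    _   _              = []
  Unique-map⁺ {xs = _ ∷ _} inj (x∉xs ∷ xs!) =
    All.map⁺ (All.tabulate λ y∈xs fx≡fy →
               All.lookup x∉xs y∈xs (inj (here refl) (there y∈xs) fx≡fy))
    ∷ Unique-map⁺ (λ x∈xs y∈xs → inj (there x∈xs) (there y∈xs)) xs!

  matching⇒length≤ : ∀ {B : Set} {R : A → B → Set} {xs} (ys : List B) → Unique xs →
    (∀ {x} → x ∈ xs → ∃[ y ] y ∈ ys × R x y) →
    (∀ {x x′ y} → x ∈ xs → x′ ∈ xs → R x y → R x′ y → x ≡ x′) →
    length xs ≤ length ys
  matching⇒length≤ {xs = []} _ _ _ _ = z≤n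
  matching⇒length≤ {R = R} {xs = x ∷ xs} ys (x∉xs ∷ xs!) match inj
    with match (here refl)
  ... | y , y∈ys , Rxy = begin
    suc (length xs)          ≤⟨ s≤s (matching⇒length≤ (ys ─ y∈ys) xs! match′ inj′) ⟩
    suc (length (ys ─ y∈ys)) ≡⟨ sym (length-removeAt′ ys (index y∈ys)) ⟩
    length ys                ∎
    where
    open ≤-Reasoning
    match′ : ∀ {x′} → x′ ∈ xs → ∃[ y′ ] y′ ∈ (ys ─ y∈ys) × R x′ y′
    match′ x′∈xs with match (there x′∈xs)
    ... | y′ , y′∈ys , Rx′y′ = y′ , ∈-─ y∈ys y′∈ys y′≢y , Rx′y′
      where
      y′≢y : y′ ≢ y
      y′≢y refl = All.lookup x∉xs x′∈xs (inj (here refl) (there x′∈xs) Rxy Rx′y′)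
    inj′ : ∀ {x₁ x₂ y′} → x₁ ∈ xs → x₂ ∈ xs → R x₁ y′ → R x₂ y′ → x₁ ≡ x₂
    inj′ x₁∈xs x₂∈xs = inj (there x₁∈xs) (there x₂∈xs)

∃-avoiding₂ : ∀ {n} → 3 ≤ n → (a b : Fin n) → ∃[ z ] z ≢ a × z ≢ b
∃-avoiding₂ (s≤s (s≤s (s≤s _))) = avoid
  where
  avoid : ∀ {m} (a b : Fin (suc (suc (suc m)))) → ∃[ z ] z ≢ a × z ≢ b
  avoid fzero           fzero           = fsuc fzero , (λ ()) , (λ ())
  avoid fzero           (fsuc fzero)    = fsuc (fsuc fzero) , (λ ()) , (λ ())
  avoid fzero           (fsuc (fsuc _)) = fsuc fzero , (λ ()) , (λ ())
  avoid (fsuc fzero)    fzero           = fsuc (fsuc fzero) , (λ ()) , (λ ())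
  avoid (fsuc (fsuc _)) fzero           = fsuc fzero , (λ ()) , (λ ())
  avoid (fsuc _)        (fsuc _)        = fzero , (λ ()) , (λ ())

module _ {n : ℕ} (G : Graph n) where

  private
    _~_ : Fin n → Fin n → Set
    _~_ = Adj G

  ~-sym : ∀ {u v} → u ~ v → v ~ u
  ~-sym {u} {v} u~v = trans (Graph.sym G v u) u~v

  ~⇒≢ : ∀ {u v} → u ~ v → u ≢ v
  ~⇒≢ {u} u~u refl with trans (sym u~u) (irrefl G u)
  ... | ()

  TriangleFree : Set
  TriangleFree = ∀ {x y z} → x ~ y → y ~ z → z ~ x → ⊥

  SquareFree : Set
  SquareFree = ∀ {x a w b} → x ≢ w → a ≢ b → x ~ a → a ~ w → w ~ b → b ~ x → ⊥

  acyclic⇒triangleFree : Acyclic G → TriangleFree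
  acyclic⇒triangleFree acyclic {x} {y} {z} x~y y~z z~x = acyclic
    (x , y ∷ z ∷ [] , s≤s (s≤s z≤n) ,
     (~⇒≢ x~y ∷ x≢z ∷ []) ∷ (~⇒≢ y~z ∷ []) ∷ [] ∷ [] , x~y , y~z , z~x , tt)
    where
    x≢z : x ≢ z
    x≢z x≡z = ~⇒≢ z~x (sym x≡z)

  acyclic⇒squareFree : Acyclic G → SquareFree
  acyclic⇒squareFree acyclic {x} {a} {w} {b} x≢w a≢b x~a a~w w~b b~x = acyclic
    (x , a ∷ w ∷ b ∷ [] , s≤s (s≤s z≤n) ,
     (~⇒≢ x~a ∷ x≢w ∷ x≢b ∷ []) ∷ (~⇒≢ a~w ∷ a≢b ∷ []) ∷ (~⇒≢ w~b ∷ []) ∷ [] ∷ [] ,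
     x~a , a~w , w~b , b~x , tt)
    where
    x≢b : x ≢ b
    x≢b x≡b = ~⇒≢ b~x (sym x≡b)

  walk-preserves : (P : Fin n → Set) → (∀ {u w} → P u → u ~ w → P w) →
                   ∀ {u v} → Walk G u v → P u → P v
  walk-preserves P closed stay         Pu = Pu
  walk-preserves P closed (step u~w w⇝v) Pu = walk-preserves P closed w⇝v (closed Pu u~w)

  walk⇒neighbour : ∀ {u v} → Walk G u v → u ≢ v → ∃ (u ~_)
  walk⇒neighbour stay           u≢u = ⊥-elim (u≢u refl)
  walk⇒neighbour (step u~w _) _   = _ , u~w

  adjacent? : ∀ v → Decidable (v ~_)
  adjacent? v w = adj G v w Bool.≟ true

  neighbours : Fin n → List (Fin n)
  neighbours v = filter (adjacent? v) (allFin n)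

  ∈-neighbours⁺ : ∀ {v w} → v ~ w → w ∈ neighbours v
  ∈-neighbours⁺ {v} {w} = ∈-filter⁺ (adjacent? v) (∈-allFin w)

  ∈-neighbours⁻ : ∀ {v w} → w ∈ neighbours v → v ~ w
  ∈-neighbours⁻ {v} w∈ = proj₂ (∈-filter⁻ (adjacent? v) {xs = allFin n} w∈)

  Internal : Fin n → Set
  Internal v = 2 ≤ length (neighbours v)

  internal? : Decidable Internal
  internal? v = 2 ≤? length (neighbours v)

  internal⇒distinct-neighbours : ∀ {v} → Internal v → ∃₂ λ a b → a ≢ b × v ~ a × v ~ b
  internal⇒distinct-neighbours {v} int
    with ∃-distinct (Unique.filter⁺ (adjacent? v) (Unique.allFin⁺ n)) int
  ... | a , b , a≢b , a∈ , b∈ = a , b , a≢b , ∈-neighbours⁻ a∈ , ∈-neighbours⁻ b∈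

  leaf-neighbour-unique : ∀ {v a b} → ¬ Internal v → v ~ a → v ~ b → a ≡ b
  leaf-neighbour-unique {v} leaf v~a v~b =
    ∈-length≤1⇒≡ (≤-pred (≰⇒> leaf)) (∈-neighbours⁺ v~a) (∈-neighbours⁺ v~b)

  adjacent-leaves-span : Connected G → ∀ {l y} → ¬ Internal l → ¬ Internal y → l ~ y →
                         ∀ z → z ≡ l ⊎ z ≡ y
  adjacent-leaves-span connected {l} {y} leaf-l leaf-y l~y z =
    walk-preserves (λ w → w ≡ l ⊎ w ≡ y) closed (connected l z) (inj₁ refl)
    where
    closed : ∀ {u w} → u ≡ l ⊎ u ≡ y → u ~ w → w ≡ l ⊎ w ≡ y
    closed (inj₁ refl) u~w = inj₂ (leaf-neighbour-unique leaf-l u~w l~y)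
    closed (inj₂ refl) u~w = inj₁ (leaf-neighbour-unique leaf-y u~w (~-sym l~y))

  leaf-neighbour-internal : Connected G → 3 ≤ n →
                            ∀ {l y} → ¬ Internal l → l ~ y → Internal y
  leaf-neighbour-internal connected 3≤n {l} {y} leaf-l l~y with internal? y
  ... | yes int-y = int-y
  ... | no leaf-y with ∃-avoiding₂ 3≤n l y
  ...   | z , z≢l , z≢y with adjacent-leaves-span connected leaf-l leaf-y l~y z
  ...     | inj₁ z≡l = ⊥-elim (z≢l z≡l)
  ...     | inj₂ z≡y = ⊥-elim (z≢y z≡y)

  leaves-on-common-neighbour : NoFalseTwins G →
    ∀ {l l′ y} → ¬ Internal l → ¬ Internal l′ → l ~ y → l′ ~ y → l ≡ l′
  leaves-on-common-neighbour noTwins {l} {l′} leaf-l leaf-l′ l~y l′~y with l ≟ l′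
  ... | yes l≡l′ = l≡l′
  ... | no l≢l′  = ⊥-elim (noTwins l l′ (l≢l′ , sameNeighbours))
    where
    sameNeighbours : ∀ w → adj G l w ≡ adj G l′ w
    sameNeighbours w = Bool.⇔→≡ {z = true} (mk⇔
      (λ l~w → subst (l′ ~_) (leaf-neighbour-unique leaf-l l~y l~w) l′~y)
      (λ l′~w → subst (l ~_) (leaf-neighbour-unique leaf-l′ l′~y l′~w) l~y))

  neighbourhood : Fin n → Subset n
  neighbourhood v = tabulate (adj G v)

  N[_] : Fin n → Subset n
  N[ v ] = ⁅ v ⁆ ∪ neighbourhood v

  ∈-N⁺ : ∀ {v w} → w ≡ v ⊎ v ~ w → w ∈ₛ N[ v ]
  ∈-N⁺ (inj₁ refl) = x∈p∪q⁺ (inj₁ (x∈⁅x⁆ _))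
  ∈-N⁺ {v} {w} (inj₂ v~w) =
    x∈p∪q⁺ (inj₂ (lookup⇒[]= w (neighbourhood v) (trans (lookup∘tabulate (adj G v) w) v~w)))

  ∈-N⁻ : ∀ {v w} → w ∈ₛ N[ v ] → w ≡ v ⊎ v ~ w
  ∈-N⁻ {v} {w} w∈ with x∈p∪q⁻ ⁅ v ⁆ (neighbourhood v) w∈
  ... | inj₁ w∈⁅v⁆ = inj₁ (x∈⁅y⁆⇒x≡y v w∈⁅v⁆)
  ... | inj₂ w∈Nv  = inj₂ (trans (sym (lookup∘tabulate (adj G v) w)) ([]=⇒lookup w∈Nv))

  ∈-N-self : ∀ v → v ∈ₛ N[ v ]
  ∈-N-self v = ∈-N⁺ (inj₁ refl)

  ∈-N-neighbour : ∀ {v w} → v ∈ₛ N[ w ] → v ≢ w → w ~ v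
  ∈-N-neighbour v∈ v≢w with ∈-N⁻ v∈
  ... | inj₁ v≡w = ⊥-elim (v≢w v≡w)
  ... | inj₂ w~v = w~v

  module _ (triangleFree : TriangleFree) where

    N-completeBipartite : ∀ {v a} → v ~ a → InducesCompleteBipartite G N[ v ]
    N-completeBipartite {v} {a} v~a =
      isCentre , (v , ∈-N-self v , isCentre-self) ,
      (a , ∈-N⁺ (inj₂ v~a) , isCentre-neighbour v~a) , sides
      where
      isCentre : Fin n → Bool
      isCentre w = does (w ≟ v)
      isCentre-self : isCentre v ≡ true
      isCentre-self with v ≟ v
      ... | yes _   = refl
      ... | no v≢v = ⊥-elim (v≢v refl)
      isCentre-neighbour : ∀ {w} → v ~ w → isCentre w ≡ false
      isCentre-neighbour {w} v~w with w ≟ v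
      ... | yes w≡v = ⊥-elim (~⇒≢ v~w (sym w≡v))
      ... | no _    = refl
      centre≢neighbour : ∀ {w} → v ~ w → isCentre v ≢ isCentre w
      centre≢neighbour v~w e with trans (sym isCentre-self) (trans e (isCentre-neighbour v~w))
      ... | ()
      sides : ∀ u w → u ∈ₛ N[ v ] → w ∈ₛ N[ v ] →
              (u ~ w → isCentre u ≢ isCentre w) × (isCentre u ≢ isCentre w → u ~ w)
      sides u w u∈ w∈ with ∈-N⁻ u∈ | ∈-N⁻ w∈
      ... | inj₁ refl | inj₁ refl = (λ v~v → ⊥-elim (~⇒≢ v~v refl)) , (λ ne → ⊥-elim (ne refl))
      ... | inj₁ refl | inj₂ v~w = (λ _ → centre≢neighbour v~w) , (λ _ → v~w)
      ... | inj₂ v~u | inj₁ refl = (λ _ e → centre≢neighbour v~u (sym e)) , (λ _ → ~-sym v~u)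
      ... | inj₂ v~u | inj₂ v~w =
        (λ u~w → ⊥-elim (triangleFree v~u u~w (~-sym v~w))) ,
        (λ ne → ⊥-elim (ne (trans (isCentre-neighbour v~u) (sym (isCentre-neighbour v~w)))))

    N-biclique : SquareFree → ∀ {v a b} → a ≢ b → v ~ a → v ~ b → IsBiclique G N[ v ]
    N-biclique squareFree {v} {a} {b} a≢b v~a v~b = N-completeBipartite v~a , maximal
      where
      maximal : ∀ S → N[ v ] ⊆ₛ S → InducesCompleteBipartite G S → S ⊆ₛ N[ v ]
      maximal S N⊆S (side , _ , _ , sides) {w} w∈S = place (w ≟ v) (side w Bool.≟ side v)
        where
        w~across : ∀ {c} → c ∈ₛ N[ v ] → side w ≢ side c → w ~ c
        w~across c∈N = proj₂ (sides w _ w∈S (N⊆S c∈N))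
        v-across : ∀ {c} → v ~ c → side v ≢ side c
        v-across v~c = proj₁ (sides v _ (N⊆S (∈-N-self v)) (N⊆S (∈-N⁺ (inj₂ v~c)))) v~c
        place : Dec (w ≡ v) → Dec (side w ≡ side v) → w ∈ₛ N[ v ]
        place (yes w≡v) _          = ∈-N⁺ (inj₁ w≡v)
        place (no _)    (no w≁v)   = ∈-N⁺ (inj₂ (~-sym (w~across (∈-N-self v) w≁v)))
        place (no w≢v)  (yes w≈v) =
          ⊥-elim (squareFree (w≢v ∘ sym) a≢b v~a (~-sym (w~ v~a)) (w~ v~b) (~-sym v~b))
          where
          w~ : ∀ {c} → v ~ c → w ~ c
          w~ v~c = w~across (∈-N⁺ (inj₂ v~c)) λ e → v-across v~c (trans (sym w≈v) e)

    N-injective : ∀ {u v a b} → a ≢ b → u ~ a → u ~ b → N[ u ] ≡ N[ v ] → u ≡ v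
    N-injective {u} {v} {a} {b} a≢b u~a u~b N≡ with u ≟ v
    ... | yes u≡v = u≡v
    ... | no u≢v  = ⊥-elim (triangleFree u~v v~c (~-sym u~c))
      where
      u~v : u ~ v
      u~v = ∈-N-neighbour (subst (v ∈ₛ_) (sym N≡) (∈-N-self v)) (λ v≡u → u≢v (sym v≡u))
      otherNeighbour : ∃[ c ] c ≢ v × u ~ c
      otherNeighbour with a ≟ v
      ... | no a≢v  = a , a≢v , u~a
      ... | yes a≡v = b , (λ b≡v → a≢b (trans a≡v (sym b≡v))) , u~b
      c = proj₁ otherNeighbour
      u~c = proj₂ (proj₂ otherNeighbour)
      v~c : v ~ c
      v~c = ∈-N-neighbour (subst (c ∈ₛ_) N≡ (∈-N⁺ (inj₂ u~c))) (proj₁ (proj₂ otherNeighbour))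

  internalVertices : List (Fin n)
  internalVertices = filter internal? (allFin n)

  leafVertices : List (Fin n)
  leafVertices = filter (∁? internal?) (allFin n)

  ∈-internalVertices⁻ : ∀ {v} → v ∈ internalVertices → Internal v
  ∈-internalVertices⁻ v∈ = proj₂ (∈-filter⁻ internal? {xs = allFin n} v∈)

  ∈-leafVertices⁻ : ∀ {v} → v ∈ leafVertices → ¬ Internal v
  ∈-leafVertices⁻ v∈ = proj₂ (∈-filter⁻ (∁? internal?) {xs = allFin n} v∈)

  #leaves≤#internal : Connected G → 3 ≤ n → NoFalseTwins G →
                      length leafVertices ≤ length internalVertices
  #leaves≤#internal connected 3≤n noTwins =
    matching⇒length≤ internalVertices (Unique.filter⁺ (∁? internal?) (Unique.allFin⁺ n)) match inj
    where
    match : ∀ {l} → l ∈ leafVertices → ∃[ y ] y ∈ internalVertices × l ~ y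
    match {l} l∈ with ∃-avoiding₂ 3≤n l l
    ... | z , z≢l , _ with walk⇒neighbour (connected l z) (z≢l ∘ sym)
    ...   | y , l~y = y , ∈-filter⁺ internal? (∈-allFin y) y-internal , l~y
      where y-internal = leaf-neighbour-internal connected 3≤n (∈-leafVertices⁻ l∈) l~y
    inj : ∀ {l l′ y} → l ∈ leafVertices → l′ ∈ leafVertices → l ~ y → l′ ~ y → l ≡ l′
    inj l∈ l′∈ = leaves-on-common-neighbour noTwins (∈-leafVertices⁻ l∈) (∈-leafVertices⁻ l′∈)

  ⌈n/2⌉≤#internal : Connected G → 3 ≤ n → NoFalseTwins G → ⌈ n /2⌉ ≤ length internalVertices
  ⌈n/2⌉≤#internal connected 3≤n noTwins = begin
    ⌈ n /2⌉                 ≤⟨ ⌈n/2⌉-mono n≤2k ⟩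
    ⌈ k + k /2⌉             ≡⟨ sym (n≡⌈n+n/2⌉ k) ⟩
    k                       ∎
    where
    open ≤-Reasoning
    k = length internalVertices
    n≤2k : n ≤ k + k
    n≤2k = begin
      n                       ≡⟨ sym (length-tabulate (λ v → v)) ⟩
      length (allFin n)       ≡⟨ sym (length-filter+length-filter-∁ internal? (allFin n)) ⟩
      k + length leafVertices ≤⟨ +-monoʳ-≤ k (#leaves≤#internal connected 3≤n noTwins) ⟩
      k + k                   ∎

  stars : List (Subset n)
  stars = map N[_] internalVertices

  stars-unique : TriangleFree → Unique stars
  stars-unique triangleFree = Unique-map⁺ injective (Unique.filter⁺ internal? (Unique.allFin⁺ n))
    where
    injective : ∀ {u v} → u ∈ internalVertices → v ∈ internalVertices → N[ u ] ≡ N[ v ] → u ≡ v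
    injective u∈ _ with internal⇒distinct-neighbours (∈-internalVertices⁻ u∈)
    ... | _ , _ , a≢b , u~a , u~b = N-injective triangleFree a≢b u~a u~b

  stars-bicliques : TriangleFree → SquareFree → All (IsBiclique G) stars
  stars-bicliques triangleFree squareFree = All.map⁺ (All.tabulate biclique)
    where
    biclique : ∀ {v} → v ∈ internalVertices → IsBiclique G N[ v ]
    biclique v∈ with internal⇒distinct-neighbours (∈-internalVertices⁻ v∈)
    ... | _ , _ , a≢b , v~a , v~b = N-biclique triangleFree squareFree a≢b v~a v~b

corollary3p5 : (n : ℕ) → 4 ≤ n → (T : Graph n) → IsTree T → NoFalseTwins T →
    Σ (List (Subset n)) λ L →
    Unique L × All (IsBiclique T) L × ⌈ n /2⌉ ≤ length L
corollary3p5 n 4≤n T (connected , acyclic) noTwins =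
  stars T ,
  stars-unique T triangleFree ,
  stars-bicliques T triangleFree (acyclic⇒squareFree T acyclic) ,
  subst (⌈ n /2⌉ ≤_) (sym (length-map (N[_] T) (internalVertices T)))
        (⌈n/2⌉≤#internal T connected (<⇒≤ 4≤n) noTwins)
  where
  triangleFree : TriangleFree T
  triangleFree = acyclic⇒triangleFree T acyclic
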